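{- Let $w$ be a non-empty finite word with minimal period length $\pi_w$. Then $\pi_w\ge R_w+|\mathrm{Alph}(w)|-1$. Moreover, if $\pi_w=R_w+|\mathrm{Alph}(w)|-1$, then $|w|=R_w+K_w+|\mathrm{Alph}(w)|-2$.
   Context: Words are finite sequences of letters $w=w_1\cdots w_n$; $|w|$ is the length and $\mathrm{Alph}(w)$ the set of letters of $w$. A positive integer $p$ is a period of $w$ if $w_i=w_{i+p}$ for all $1\le i\le |w|-p$; $\pi_w$ is the smallest period. A factor is a contiguous subword. A factor $u$ of $w$ is right special if $ux$ is a factor of $w$ for at least two distinct letters $x$. $R_w$ is the smallest positive integer $r$ such that $w$ has no right special factor of length $r$; $K_w$ is the length of the shortest suffix of $w$ occurring exactly once in $w$. -}

module Defs where

open import Data.List using (List; []; _∷_; _++_; [_]; length)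
open import Data.Nat using (ℕ; _≤_; _<_)
open import Data.Product using (Σ; ∃; _×_; _,_)
open import Relation.Binary.PropositionalEquality using (_≡_; _≢_)
open import Relation.Nullary using (¬_)

module _ {A : Set} where

  LetterAt : List A → ℕ → A → Set
  LetterAt w i a = Σ (List A) λ xs → Σ (List A) λ ys → length xs ≡ i × xs ++ a ∷ ys ≡ w

  IsPeriod : List A → ℕ → Set
  IsPeriod w p = 1 ≤ p × (∀ i a b → LetterAt w i a → LetterAt w (i Data.Nat.+ p) b → a ≡ b)

  IsMinPeriod : List A → ℕ → Set
  IsMinPeriod w p = IsPeriod w p × (∀ q → IsPeriod w q → p ≤ q)

  Factor : List A → List A → Set
  Factor u w = Σ (List A) λ xs → Σ (List A) λ ys → xs ++ u ++ ys ≡ w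

  RightSpecial : List A → List A → Set
  RightSpecial u w = Σ A λ x → Σ A λ y → x ≢ y × Factor (u ++ [ x ]) w × Factor (u ++ [ y ]) w

  HasRSOfLength : List A → ℕ → Set
  HasRSOfLength w r = Σ (List A) λ u → length u ≡ r × RightSpecial u w

  IsR : List A → ℕ → Set
  IsR w r = 1 ≤ r × ¬ HasRSOfLength w r × (∀ r′ → 1 ≤ r′ → r′ < r → HasRSOfLength w r′)

  OccursAt : List A → List A → ℕ → Set
  OccursAt u w i = Σ (List A) λ xs → Σ (List A) λ ys → length xs ≡ i × xs ++ u ++ ys ≡ w

  OccursOnce : List A → List A → Set
  OccursOnce u w = Σ ℕ λ i → OccursAt u w i × (∀ j → OccursAt u w j → j ≡ i)

  Suffix : List A → List A → Set
  Suffix u w = Σ (List A) λ xs → xs ++ u ≡ w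

  IsK : List A → ℕ → Set
  IsK w k = (Σ (List A) λ u → Suffix u w × OccursOnce u w × length u ≡ k)
          × (∀ u → Suffix u w → OccursOnce u w → k ≤ length u)

module Submission where

-- For 0 ≤ m ≤ n = |w| call a position i a *last occurrence* of
-- length m if the factor of length m starting at i occurs at no later
-- position; the number C(m) of such positions is the number of distinct
-- factors of length m (the factor complexity of w).  Passing from m to m + 1
--   * at most one last occurrence is lost (the one at n - m, where the window
--     no longer fits), so C(m) ≤ C(m + 1) + 1;
--   * if m < K, the suffix of length m occurs earlier too, and the last
--     occurrence of its (m+1)-extension is a new last occurrence;
--   * if m < R, a right special factor u of length m has two extensions ux ≠ uy
--     whose last occurrences cannot both be last occurrences of u;
--   * if both hold, these give two distinct new last occurrences.
-- Telescoping from m = 1 (where C(1) ≥ |Alph(w)|) to m = n + 1 (where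
-- C(n + 1) = 0) gives |Alph(w)| + (K - 1) + (R - 1) ≤ n.  Independently, any
-- period p satisfies n < p + K, since otherwise the unique suffix of length K
-- would reappear p positions earlier (only the period property of π_w is
-- used, not its minimality).  Both parts of the theorem are arithmetic
-- consequences of these two inequalities.

open import Defs
open import Data.List using (List; []; _∷_; _++_; [_]; length; take; drop; deduplicate; filter)
open import Data.List.Properties
  using (length-take; take-take; take++drop≡id; length-++; ++-identityʳ; take-all; length-drop;
         ∷ʳ-injectiveʳ; ≡-dec; filter-notAll; length-filter)
open import Data.List.Membership.Propositional using (_∈_)
open import Data.List.Membership.Propositional.Properties using (∈-deduplicate⁺)
open import Data.List.Relation.Unary.Any using (here; there)
import Data.List.Relation.Unary.Any as Any
import Data.List.Membership.DecPropositional as DecMembership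
open import Data.Nat
open import Data.Nat.Properties
open import Data.Nat.Tactic.RingSolver using (solve-∀)
open import Data.Product using (Σ; _×_; _,_; proj₁; proj₂)
open import Data.Sum using (_⊎_; inj₁; inj₂)
open import Function using (_∘_)
open import Relation.Nullary using (¬_; yes; no; ¬?; contradiction)
open import Relation.Nullary.Decidable using (_×-dec_; _⊎-dec_; _→-dec_; map′)
open import Relation.Unary using (Decidable)
open import Relation.Binary.Definitions using (DecidableEquality; tri<; tri≈; tri>)
open import Relation.Binary.PropositionalEquality
  using (_≡_; _≢_; refl; sym; trans; cong; cong₂; subst; subst₂; module ≡-Reasoning)

count : {P : ℕ → Set} → Decidable P → ℕ → ℕ
count P? zero = 0
count P? (suc N) with P? N
... | yes _ = suc (count P? N)
... | no _  = count P? N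

module _ {P : ℕ → Set} (P? : Decidable P) where

  count-none : ∀ N → (∀ i → ¬ P i) → count P? N ≡ 0
  count-none zero    none = refl
  count-none (suc N) none with P? N
  ... | yes p = contradiction p (none N)
  ... | no _  = count-none N none

  -- Counting on {1, …, N} versus {0, …, N}: shifting can only lose the
  -- position 0, and loses it exactly when P 0 holds.
  count-shift : ∀ N → count (P? ∘ suc) N ≤ count P? (suc N)
  count-shift zero = z≤n
  count-shift (suc N) with P? (suc N)
  ... | yes _ = s≤s (count-shift N)
  ... | no _  = count-shift N

  count-shift-zero : P 0 → ∀ N → suc (count (P? ∘ suc) N) ≤ count P? (suc N)
  count-shift-zero p0 zero with P? 0
  ... | yes _ = s≤s z≤n
  ... | no ¬p = contradiction p0 ¬p
  count-shift-zero p0 (suc N) with P? (suc N)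
  ... | yes _ = s≤s (count-shift-zero p0 N)
  ... | no _  = count-shift-zero p0 N

module _ {P Q : ℕ → Set} (P? : Decidable P) (Q? : Decidable Q) where

  count-mono : ∀ N → (∀ i → i < N → P i → Q i) → count P? N ≤ count Q? N
  count-mono zero    P⊆Q = z≤n
  count-mono (suc N) P⊆Q with P? N | Q? N
  ... | yes _ | yes _ = s≤s (count-mono N λ i i<N → P⊆Q i (m<n⇒m<1+n i<N))
  ... | yes p | no ¬q = contradiction (P⊆Q N ≤-refl p) ¬q
  ... | no _  | yes _ = m≤n⇒m≤1+n (count-mono N λ i i<N → P⊆Q i (m<n⇒m<1+n i<N))
  ... | no _  | no _  = count-mono N λ i i<N → P⊆Q i (m<n⇒m<1+n i<N)

  count-mono-strict : (∀ i → P i → Q i) → ∀ N a → a < N → Q a → ¬ P a →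
                      suc (count P? N) ≤ count Q? N
  count-mono-strict P⊆Q (suc N) a a<1+N qa ¬pa with P? N | Q? N
  ... | yes p | yes _ = s≤s (count-mono-strict P⊆Q N a a<N qa ¬pa)
    where
    a<N : a < N
    a<N = ≤∧≢⇒< (≤-pred a<1+N) λ { refl → ¬pa p }
  ... | yes p | no ¬q = contradiction (P⊆Q N p) ¬q
  ... | no _  | yes _ = s≤s (count-mono N λ i _ → P⊆Q i)
  ... | no _  | no ¬q = count-mono-strict P⊆Q N a a<N qa ¬pa
    where
    a<N : a < N
    a<N = ≤∧≢⇒< (≤-pred a<1+N) λ { refl → ¬q qa }

module _ {P Q : ℕ → Set} (P? : Decidable P) (Q? : Decidable Q) (e : ℕ)
         (P⊆Q∪e : ∀ i → P i → Q i ⊎ i ≡ e) where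

  count-lose-one : ∀ N → count P? N ≤ suc (count Q? N)
  count-lose-one zero = z≤n
  count-lose-one (suc N) with P? N | Q? N
  ... | yes _ | yes _ = s≤s (count-lose-one N)
  ... | no _  | yes _ = m≤n⇒m≤1+n (count-lose-one N)
  ... | no _  | no _  = count-lose-one N
  ... | yes p | no ¬q with P⊆Q∪e N p
  ...   | inj₁ q   = contradiction q ¬q
  ...   | inj₂ N≡e = s≤s (count-mono P? Q? N below)
    where
    -- below N the exceptional point e = N is out of range
    below : ∀ i → i < N → P i → Q i
    below i i<N pi with P⊆Q∪e i pi
    ... | inj₁ qi  = qi
    ... | inj₂ i≡e = contradiction (trans i≡e (sym N≡e)) (<⇒≢ i<N)

module _ {P Q : ℕ → Set} (P? : Decidable P) (Q? : Decidable Q) (e : ℕ)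
         (P⊆Q∪e : ∀ i → P i → Q i ⊎ i ≡ e) (N : ℕ) where

  private
    _+ₚ_ : {R : ℕ → Set} → Decidable R → (a : ℕ) → Decidable (λ i → R i ⊎ i ≡ a)
    (R? +ₚ a) i = R? i ⊎-dec (i ≟ a)

    count-insert : {R : ℕ → Set} (R? : Decidable R) (a : ℕ) → a < N → ¬ R a →
                   suc (count R? N) ≤ count (R? +ₚ a) N
    count-insert R? a a<N ¬ra = count-mono-strict R? (R? +ₚ a) (λ _ → inj₁) N a a<N (inj₂ refl) ¬ra

  count-one-new : ∀ a → a < N → Q a → ¬ P a → count P? N ≤ count Q? N
  count-one-new a a<N qa ¬pa = ≤-pred (begin
    suc (count P? N)        ≤⟨ count-insert P? a a<N ¬pa ⟩
    count (P? +ₚ a) N       ≤⟨ count-lose-one (P? +ₚ a) Q? e P+a⊆Q∪e N ⟩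
    suc (count Q? N)        ∎)
    where
    open ≤-Reasoning
    P+a⊆Q∪e : ∀ i → P i ⊎ i ≡ a → Q i ⊎ i ≡ e
    P+a⊆Q∪e i (inj₁ pi)   = P⊆Q∪e i pi
    P+a⊆Q∪e i (inj₂ refl) = inj₁ qa

  count-two-new : ∀ a b → a < N → b < N → a ≢ b → Q a → ¬ P a → Q b → ¬ P b →
                  suc (count P? N) ≤ count Q? N
  count-two-new a b a<N b<N a≢b qa ¬pa qb ¬pb = ≤-pred (begin
    suc (suc (count P? N))      ≤⟨ s≤s (count-insert P? a a<N ¬pa) ⟩
    suc (count (P? +ₚ a) N)     ≤⟨ count-insert (P? +ₚ a) b b<N ¬P+a-b ⟩
    count ((P? +ₚ a) +ₚ b) N    ≤⟨ count-lose-one ((P? +ₚ a) +ₚ b) Q? e P+a+b⊆Q∪e N ⟩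
    suc (count Q? N)            ∎)
    where
    open ≤-Reasoning
    ¬P+a-b : ¬ (P b ⊎ b ≡ a)
    ¬P+a-b (inj₁ pb)  = ¬pb pb
    ¬P+a-b (inj₂ b≡a) = a≢b (sym b≡a)
    P+a+b⊆Q∪e : ∀ i → (P i ⊎ i ≡ a) ⊎ i ≡ b → Q i ⊎ i ≡ e
    P+a+b⊆Q∪e i (inj₁ (inj₁ pi))   = P⊆Q∪e i pi
    P+a+b⊆Q∪e i (inj₁ (inj₂ refl)) = inj₁ qa
    P+a+b⊆Q∪e i (inj₂ refl)        = inj₁ qb

largest-solution : {Q : ℕ → Set} → Decidable Q → ∀ N i → i < N → Q i →
                   Σ ℕ λ a → a < N × Q a × (∀ j → a < j → j < N → ¬ Q j)
largest-solution {Q} Q? (suc N) i i<1+N qi with Q? N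
... | yes qN = N , ≤-refl , qN , λ j N<j j<1+N → contradiction (≤-trans j<1+N N<j) (<-irrefl refl)
... | no ¬qN with largest-solution Q? N i (≤∧≢⇒< (≤-pred i<1+N) λ { refl → ¬qN qi }) qi
...   | a , a<N , qa , above = a , m<n⇒m<1+n a<N , qa , above′
  where
  above′ : ∀ j → a < j → j < suc N → ¬ Q j
  above′ j a<j j<1+N qj with j ≟ N
  ... | yes refl = ¬qN qj
  ... | no j≢N   = above j a<j (≤∧≢⇒< (≤-pred j<1+N) j≢N) qj

window-start : ∀ {n} i {m} → i + m ≤ n → i < suc n
window-start i {m} fits = s≤s (≤-trans (m≤m+n i m) fits)

shorter-fits : ∀ {n} i m → i + suc m ≤ n → i + m ≤ n
shorter-fits i m fits = ≤-trans (+-monoʳ-≤ i (n≤1+n m)) fits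

before-last-window : ∀ {n} j m → j + suc m ≤ n → j < n ∸ m
before-last-window {n} j m fits = m+n≤o⇒m≤o∸n (suc j) (subst (_≤ n) (+-suc j m) fits)

before-last-window⁻ : ∀ {n} j m → m ≤ n → j < n ∸ m → j + suc m ≤ n
before-last-window⁻ {n} j m m≤n j<n∸m =
  subst (_≤ n) (sym (+-suc j m)) (m≤o∸n⇒m+n≤o (suc j) m≤n j<n∸m)

<∸1⇒suc< : ∀ {t k} → t < k ∸ 1 → suc t < k
<∸1⇒suc< {k = suc k} t<k = s≤s t<k

⊓-step : ∀ t κ → (t < κ × suc t ⊓ κ ≡ 1 + t ⊓ κ) ⊎ (suc t ⊓ κ ≡ 0 + t ⊓ κ)
⊓-step t       zero    = inj₂ (sym (⊓-zeroʳ t))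
⊓-step zero    (suc κ) = inj₁ (s≤s z≤n , refl)
⊓-step (suc t) (suc κ) with ⊓-step t κ
... | inj₁ (t<κ , eq) = inj₁ (s≤s t<κ , cong suc eq)
... | inj₂ eq         = inj₂ (cong suc eq)

telescope-step : ∀ {x a b a′ b′ α β g g′ t} → a′ ≡ α + a → b′ ≡ β + b →
                 x + a + b ≤ g + t → α + β + g ≤ suc g′ → x + a′ + b′ ≤ g′ + suc t
telescope-step {x} {a} {b} {_} {_} {α} {β} {g} {g′} {t} refl refl inv step = begin
  x + (α + a) + (β + b)  ≡⟨ regroup x a b α β ⟩
  α + β + (x + a + b)    ≤⟨ +-monoʳ-≤ (α + β) inv ⟩
  α + β + (g + t)        ≡⟨ sym (+-assoc (α + β) g t) ⟩
  α + β + g + t          ≤⟨ +-monoˡ-≤ t step ⟩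
  suc g′ + t             ≡⟨ sym (+-suc g′ t) ⟩
  g′ + suc t             ∎
  where
  open ≤-Reasoning
  regroup : ∀ x a b α β → x + (α + a) + (β + b) ≡ α + β + (x + a + b)
  regroup = solve-∀

telescope : (G : ℕ → ℕ) (κ ρ : ℕ) →
  (∀ t → G t ≤ suc (G (suc t))) →
  (∀ t → t < κ → G t ≤ G (suc t)) →
  (∀ t → t < ρ → G t ≤ G (suc t)) →
  (∀ t → t < κ → t < ρ → suc (G t) ≤ G (suc t)) →
  ∀ t → G 0 + t ⊓ κ + t ⊓ ρ ≤ G t + t
telescope G κ ρ lose stallκ stallρ grow zero = ≤-reflexive (+-identityʳ (G 0 + 0))
telescope G κ ρ lose stallκ stallρ grow (suc t)
  with telescope G κ ρ lose stallκ stallρ grow t | ⊓-step t κ | ⊓-step t ρ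
... | ih | inj₁ (t<κ , eκ) | inj₁ (t<ρ , eρ) = telescope-step eκ eρ ih (s≤s (grow t t<κ t<ρ))
... | ih | inj₁ (t<κ , eκ) | inj₂ eρ         = telescope-step eκ eρ ih (s≤s (stallκ t t<κ))
... | ih | inj₂ eκ         | inj₁ (t<ρ , eρ) = telescope-step eκ eρ ih (s≤s (stallρ t t<ρ))
... | ih | inj₂ eκ         | inj₂ eρ         = telescope-step eκ eρ ih (lose t)

module _ {A : Set} where

  factorAt : List A → ℕ → ℕ → List A
  factorAt w i m = take m (drop i w)

  take-length-++ : (xs ys : List A) → take (length xs) (xs ++ ys) ≡ xs
  take-length-++ []       ys = refl
  take-length-++ (x ∷ xs) ys = cong (x ∷_) (take-length-++ xs ys)

  drop-length-++ : (xs ys : List A) → drop (length xs) (xs ++ ys) ≡ ys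
  drop-length-++ []       ys = refl
  drop-length-++ (x ∷ xs) ys = drop-length-++ xs ys

  length-snoc : (u : List A) (x : A) → length (u ++ [ x ]) ≡ suc (length u)
  length-snoc u x = trans (length-++ u) (+-comm (length u) 1)

  occurrence⇒factorAt : (w xs v ys : List A) → xs ++ v ++ ys ≡ w →
    factorAt w (length xs) (length v) ≡ v × length xs + length v ≤ length w
  occurrence⇒factorAt w xs v ys refl =
    trans (cong (take (length v)) (drop-length-++ xs (v ++ ys))) (take-length-++ v ys) ,
    (begin
      length xs + length v               ≤⟨ +-monoʳ-≤ (length xs) (m≤m+n (length v) (length ys)) ⟩
      length xs + (length v + length ys) ≡⟨ cong (length xs +_) (sym (length-++ v)) ⟩
      length xs + length (v ++ ys)       ≡⟨ sym (length-++ xs) ⟩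
      length (xs ++ v ++ ys)             ∎)
    where open ≤-Reasoning

  length-factorAt : (w : List A) (i m : ℕ) → i + m ≤ length w → length (factorAt w i m) ≡ m
  length-factorAt w       zero    m fits      = trans (length-take m w) (m≤n⇒m⊓n≡m fits)
  length-factorAt (x ∷ w) (suc i) m (s≤s fits) = length-factorAt w i m fits

  factorAt-occurs : (w : List A) (i m : ℕ) → i + m ≤ length w → OccursAt (factorAt w i m) w i
  factorAt-occurs w i m fits =
    take i w , drop m (drop i w) ,
    trans (length-take i w) (m≤n⇒m⊓n≡m (≤-trans (m≤m+n i m) fits)) ,
    trans (cong (take i w ++_) (take++drop≡id m (drop i w))) (take++drop≡id i w)

  factorAt-prefix : (w : List A) (i m : ℕ) → take m (factorAt w i (suc m)) ≡ factorAt w i m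
  factorAt-prefix w i m = trans (take-take m (suc m) (drop i w))
                                (cong (λ l → take l (drop i w)) (m≤n⇒m⊓n≡m (n≤1+n m)))

  factorAt-shorten : (w : List A) (i j m : ℕ) → factorAt w i (suc m) ≡ factorAt w j (suc m) →
                     factorAt w i m ≡ factorAt w j m
  factorAt-shorten w i j m same = begin
    factorAt w i m                  ≡⟨ sym (factorAt-prefix w i m) ⟩
    take m (factorAt w i (suc m))   ≡⟨ cong (take m) same ⟩
    take m (factorAt w j (suc m))   ≡⟨ factorAt-prefix w j m ⟩
    factorAt w j m                  ∎
    where open ≡-Reasoning

  factorAt-suffix : (w : List A) (m : ℕ) → m ≤ length w →
                    factorAt w (length w ∸ m) m ≡ drop (length w ∸ m) w
  factorAt-suffix w m m≤n = take-all m (drop (length w ∸ m) w)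
    (≤-reflexive (trans (length-drop (length w ∸ m) w) (m∸[m∸n]≡n m≤n)))

  drop-letter : (w : List A) (i : ℕ) → i < length w →
                Σ A λ a → LetterAt w i a × drop i w ≡ a ∷ drop (suc i) w
  drop-letter (x ∷ w) zero    _       = x , ([] , w , refl , refl) , refl
  drop-letter (x ∷ w) (suc i) (s≤s i<n) with drop-letter w i i<n
  ... | a , (xs , ys , len , eq) , split = a , (x ∷ xs , ys , cong suc len , cong (x ∷_) eq) , split

  period-shift : (w : List A) (p : ℕ) → IsPeriod w p →
                 ∀ m i → i + p + m ≤ length w → factorAt w i m ≡ factorAt w (i + p) m
  period-shift w p per zero    i fits = refl
  period-shift w p per (suc m) i fits
    with drop-letter w i (≤-<-trans (m≤m+n i p) (<-≤-trans (m<m+n (i + p) z<s) fits))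
       | drop-letter w (i + p) (<-≤-trans (m<m+n (i + p) z<s) fits)
  ... | a , at-i , split-i | b , at-i+p , split-i+p = begin
    take (suc m) (drop i w)        ≡⟨ cong (take (suc m)) split-i ⟩
    a ∷ factorAt w (suc i) m       ≡⟨ cong₂ _∷_ (proj₂ per i a b at-i at-i+p)
                                                (period-shift w p per m (suc i) fits′) ⟩
    b ∷ factorAt w (suc i + p) m   ≡⟨ cong (take (suc m)) (sym split-i+p) ⟩
    take (suc m) (drop (i + p) w)  ∎
    where
    open ≡-Reasoning
    fits′ : suc i + p + m ≤ length w
    fits′ = subst (_≤ length w) (+-suc (i + p) m) fits

  LastOcc : List A → ℕ → ℕ → Set
  LastOcc w m i = i + m ≤ length w ×
                  (∀ j → i < j → j + m ≤ length w → factorAt w j m ≢ factorAt w i m)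

  -- Being a last occurrence is decidable: all quantifiers range over 0 … |w|.
  lastOcc? : DecidableEquality A → ∀ w m → Decidable (LastOcc w m)
  lastOcc? _≟_ w m i = (i + m ≤? length w) ×-dec
    map′ (λ h j i<j fits → h (window-start j fits) i<j fits) (λ h {j} _ → h j)
         (allUpTo? (λ j → (i <? j) →-dec (j + m ≤? length w) →-dec
                          ¬? (≡-dec _≟_ (factorAt w j m) (factorAt w i m)))
                   (suc (length w)))

  -- The number of positions that are last occurrences of their factor of
  -- length m, i.e. the number of distinct factors of length m of w.
  complexity : DecidableEquality A → List A → ℕ → ℕ
  complexity _≟_ w m = count (lastOcc? _≟_ w m) (suc (length w))

  laterCopy-notLast : ∀ w m i j → i < j → j + m ≤ length w →
                      factorAt w j m ≡ factorAt w i m → ¬ LastOcc w m i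
  laterCopy-notLast w m i j i<j fits same (_ , later) = later j i<j fits same

  copies-notBothLast : ∀ w m a b → a ≢ b → a + m ≤ length w → b + m ≤ length w →
                       factorAt w a m ≡ factorAt w b m → ¬ LastOcc w m a ⊎ ¬ LastOcc w m b
  copies-notBothLast w m a b a≢b a-fits b-fits same with <-cmp a b
  ... | tri< a<b _ _ = inj₁ (laterCopy-notLast w m a b a<b b-fits (sym same))
  ... | tri≈ _ a≡b _ = contradiction a≡b a≢b
  ... | tri> _ _ b<a = inj₂ (laterCopy-notLast w m b a b<a a-fits same)

  lastOcc-extends : ∀ w m i → LastOcc w m i → LastOcc w (suc m) i ⊎ i ≡ length w ∸ m
  lastOcc-extends w m i (fits , later) with i + m ≟ length w
  ... | yes i+m≡n = inj₂ (trans (sym (m+n∸n≡m i m)) (cong (_∸ m) i+m≡n))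
  ... | no  i+m≢n = inj₁ (subst (_≤ length w) (sym (+-suc i m)) (≤∧≢⇒< fits i+m≢n) , later′)
    where
    later′ : ∀ j → i < j → j + suc m ≤ length w → factorAt w j (suc m) ≢ factorAt w i (suc m)
    later′ j i<j fits′ same =
      later j i<j (shorter-fits j m fits′) (factorAt-shorten w j i m same)

  lastOccurrence : DecidableEquality A → ∀ w m i → i + m ≤ length w →
                   Σ ℕ λ g → LastOcc w m g × factorAt w g m ≡ factorAt w i m
  lastOccurrence _≟_ w m i fits
    with largest-solution Copy? (suc (length w)) i (window-start i fits) (fits , refl)
    where
    Copy : ℕ → Set
    Copy j = j + m ≤ length w × factorAt w j m ≡ factorAt w i m
    Copy? : Decidable Copy
    Copy? j = (j + m ≤? length w) ×-dec ≡-dec _≟_ (factorAt w j m) (factorAt w i m)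
  ... | g , _ , (g-fits , g-copy) , above =
    g , (g-fits , λ j g<j j-fits same → above j g<j (window-start j j-fits) (j-fits , trans same g-copy)) ,
    g-copy

  module _ (_≟_ : DecidableEquality A) (w : List A) (m : ℕ) where

    complexity-lose-one : complexity _≟_ w m ≤ suc (complexity _≟_ w (suc m))
    complexity-lose-one = count-lose-one (lastOcc? _≟_ w m) (lastOcc? _≟_ w (suc m))
                            (length w ∸ m) (lastOcc-extends w m) (suc (length w))

    complexity-one-new : ∀ c → LastOcc w (suc m) c → ¬ LastOcc w m c →
                         complexity _≟_ w m ≤ complexity _≟_ w (suc m)
    complexity-one-new c last ¬last =
      count-one-new (lastOcc? _≟_ w m) (lastOcc? _≟_ w (suc m)) (length w ∸ m) (lastOcc-extends w m)
        (suc (length w)) c (window-start c (proj₁ last)) last ¬last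

    complexity-two-new : ∀ c d → c ≢ d → LastOcc w (suc m) c → ¬ LastOcc w m c →
                         LastOcc w (suc m) d → ¬ LastOcc w m d →
                         suc (complexity _≟_ w m) ≤ complexity _≟_ w (suc m)
    complexity-two-new c d c≢d last-c ¬last-c last-d ¬last-d =
      count-two-new (lastOcc? _≟_ w m) (lastOcc? _≟_ w (suc m)) (length w ∸ m) (lastOcc-extends w m)
        (suc (length w)) c d (window-start c (proj₁ last-c)) (window-start d (proj₁ last-d))
        c≢d last-c ¬last-c last-d ¬last-d

  complexity-beyond : (_≟_ : DecidableEquality A) (w : List A) → complexity _≟_ w (suc (length w)) ≡ 0
  complexity-beyond _≟_ w = count-none (lastOcc? _≟_ w (suc (length w))) (suc (length w))
    λ i (fits , _) → 1+n≰n (≤-trans (m≤n+m (suc (length w)) i) fits)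

module _ {A : Set} (w : List A) where

  factor-length : ∀ u → Factor u w → length u ≤ length w
  factor-length u (xs , ys , occ) =
    ≤-trans (m≤n+m (length u) (length xs)) (proj₂ (occurrence⇒factorAt w xs u ys occ))

  suffix⇒factor : ∀ u → Suffix u w → Factor u w
  suffix⇒factor u (xs , eq) = xs , [] , trans (cong (xs ++_) (++-identityʳ u)) eq

  UniqueSuffixesFrom : ℕ → Set
  UniqueSuffixesFrom k = ∀ u → Suffix u w → OccursOnce u w → k ≤ length u

  -- K_w ≤ |w| and R_w - 1 ≤ |w|: the witnesses are factors of w.
  K≤length : ∀ k → IsK w k → k ≤ length w
  K≤length k ((u , suffix , _ , refl) , _) = factor-length u (suffix⇒factor u suffix)

  R∸1≤length : ∀ r → IsR w r → r ∸ 1 ≤ length w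
  R∸1≤length zero          _ = z≤n
  R∸1≤length (suc zero)    _ = z≤n
  R∸1≤length (suc (suc r)) (_ , _ , below-R) with below-R (suc r) (s≤s z≤n) ≤-refl
  ... | u , len , x , _ , _ , ux-factor , _ = begin
    suc r                ≡⟨ sym len ⟩
    length u             ≤⟨ n≤1+n (length u) ⟩
    suc (length u)       ≡⟨ sym (length-snoc u x) ⟩
    length (u ++ [ x ])  ≤⟨ factor-length (u ++ [ x ]) ux-factor ⟩
    length w             ∎
    where open ≤-Reasoning

  -- A nonempty word has no unique empty suffix, so K_w ≥ 1.
  K-positive : ∀ k → IsK w k → 1 ≤ length w → 1 ≤ k
  K-positive (suc k) _ _ = s≤s z≤n
  K-positive zero (([] , _ , (_ , _ , unique) , _) , _) 1≤n =
    contradiction (trans (unique 0 (factorAt-occurs w 0 0 z≤n)) (sym (unique 1 (factorAt-occurs w 1 0 1≤n))))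
                  λ ()

  -- Every period p satisfies |w| < p + K_w: otherwise the unique suffix of
  -- length K_w would reappear p positions earlier.
  period-bound : ∀ p k → IsPeriod w p → IsK w k → length w < p + k
  period-bound p k per@(1≤p , _) ((u , (xs , suffix) , (i₀ , _ , unique) , refl) , _)
    with length w <? p + length u
  ... | yes n<p+k = n<p+k
  ... | no  n≮p+k = contradiction (+-cancelˡ-≡ i p 0 i+p≡i+0) (λ p≡0 → <⇒≢ 1≤p (sym p≡0))
    where
    e : ℕ
    e = length xs
    suffix′ : xs ++ u ++ [] ≡ w
    suffix′ = proj₂ (proj₂ (suffix⇒factor u (xs , suffix)))
    e+k≡n : e + k ≡ length w
    e+k≡n = sym (trans (cong length (sym suffix)) (length-++ xs))
    p≤e : p ≤ e
    p≤e = +-cancelʳ-≤ k p e (subst (p + k ≤_) (sym e+k≡n) (≮⇒≥ n≮p+k))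
    i : ℕ
    i = e ∸ p
    i+p≡e : i + p ≡ e
    i+p≡e = m∸n+n≡m p≤e
    i+p+k≤n : i + p + k ≤ length w
    i+p+k≤n = ≤-reflexive (trans (cong (_+ k) i+p≡e) e+k≡n)
    copy-at-i : factorAt w i k ≡ u
    copy-at-i = begin
      factorAt w i k        ≡⟨ period-shift w p per k i i+p+k≤n ⟩
      factorAt w (i + p) k  ≡⟨ cong (λ j → factorAt w j k) i+p≡e ⟩
      factorAt w e k        ≡⟨ proj₁ (occurrence⇒factorAt w xs u [] suffix′) ⟩
      u                     ∎
      where open ≡-Reasoning
    occurs-at-i : OccursAt u w i
    occurs-at-i = subst (λ v → OccursAt v w i) copy-at-i
      (factorAt-occurs w i k (≤-trans (+-monoˡ-≤ k (m≤m+n i p)) i+p+k≤n))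
    occurs-at-e : OccursAt u w e
    occurs-at-e = xs , [] , refl , suffix′
    i+p≡i+0 : i + p ≡ i + 0
    i+p≡i+0 = begin
      i + p  ≡⟨ i+p≡e ⟩
      e      ≡⟨ unique e occurs-at-e ⟩
      i₀     ≡⟨ sym (unique i occurs-at-i) ⟩
      i      ≡⟨ sym (+-identityʳ i) ⟩
      i + 0  ∎
      where open ≡-Reasoning

module _ {A : Set} (_≟_ : DecidableEquality A) (w : List A) where

  suffixFactor : ℕ → List A
  suffixFactor m = factorAt w (length w ∸ m) m

  suffixCopy-notLast : ∀ m j → j + suc m ≤ length w → factorAt w j m ≡ suffixFactor m →
                       ¬ LastOcc w m j
  suffixCopy-notLast m j fits same =
    laterCopy-notLast w m j (length w ∸ m) (before-last-window j m fits)
      (≤-reflexive (m∸n+n≡m m≤n)) (sym same)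
    where
    m≤n : m ≤ length w
    m≤n = ≤-trans (m≤n+m m (suc j)) (subst (_≤ length w) (+-suc j m) fits)

  suffix-recurs : ∀ k → UniqueSuffixesFrom w k → k ≤ length w →
                  ∀ m → m < k → Σ ℕ λ j → j + suc m ≤ length w × factorAt w j m ≡ suffixFactor m
  suffix-recurs k K-min k≤n m m<k
    with anyUpTo? (λ j → ≡-dec _≟_ (factorAt w j m) (suffixFactor m)) (length w ∸ m)
  ... | yes (j , j<e , copy) = j , before-last-window⁻ j m (≤-trans (<⇒≤ m<k) k≤n) j<e , copy
  ... | no none = contradiction (K-min (suffixFactor m) isSuffix occursOnce) (<⇒≱ (subst (_< k) (sym len) m<k))
    where
    m≤n : m ≤ length w
    m≤n = ≤-trans (<⇒≤ m<k) k≤n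
    e : ℕ
    e = length w ∸ m
    e+m≡n : e + m ≡ length w
    e+m≡n = m∸n+n≡m m≤n
    len : length (suffixFactor m) ≡ m
    len = length-factorAt w e m (≤-reflexive e+m≡n)
    isSuffix : Suffix (suffixFactor m) w
    isSuffix = take e w , trans (cong (take e w ++_) (factorAt-suffix w m m≤n)) (take++drop≡id e w)
    only-at-e : ∀ j → OccursAt (suffixFactor m) w j → j ≡ e
    only-at-e j (xs , ys , refl , occ) with occurrence⇒factorAt w xs (suffixFactor m) ys occ
    ... | copy , fits with length xs <? e
    ...   | yes j<e = contradiction (length xs , j<e , subst (λ l → factorAt w (length xs) l ≡ suffixFactor m) len copy)
                                    none
    ...   | no  j≮e = ≤-antisym (+-cancelʳ-≤ m (length xs) e (subst₂ (λ l n → length xs + l ≤ n) len (sym e+m≡n) fits))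
                                (≮⇒≥ j≮e)
    occursOnce : OccursOnce (suffixFactor m) w
    occursOnce = e , factorAt-occurs w e m (≤-reflexive e+m≡n) , only-at-e

  -- Hence for m < k the suffix of length m gives a new last occurrence: the
  -- last occurrence of the extension of an earlier copy of it.
  suffix-newLast : ∀ k → UniqueSuffixesFrom w k → k ≤ length w →
                   ∀ m → m < k →
                   Σ ℕ λ g → LastOcc w (suc m) g × ¬ LastOcc w m g × factorAt w g m ≡ suffixFactor m
  suffix-newLast k K-min k≤n m m<k with suffix-recurs k K-min k≤n m m<k
  ... | j , j-fits , copy with lastOccurrence _≟_ w (suc m) j j-fits
  ...   | g , last , same = g , last , suffixCopy-notLast m g (proj₁ last) g-copy , g-copy
    where
    g-copy : factorAt w g m ≡ suffixFactor m
    g-copy = trans (factorAt-shorten w g j m same) copy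

  extension-lastOcc : ∀ m (u : List A) (x : A) → length u ≡ m → Factor (u ++ [ x ]) w →
    Σ ℕ λ a → LastOcc w (suc m) a × factorAt w a (suc m) ≡ u ++ [ x ] × factorAt w a m ≡ u
  extension-lastOcc m u x refl (xs , ys , occ)
    with occurrence⇒factorAt w xs (u ++ [ x ]) ys occ
  ... | copy , fits
    with lastOccurrence _≟_ w (suc m) (length xs) (subst (λ l → length xs + l ≤ length w) (length-snoc u x) fits)
  ...   | a , last , same = a , last , ux , (begin
    factorAt w a m                ≡⟨ sym (factorAt-prefix w a m) ⟩
    take m (factorAt w a (suc m)) ≡⟨ cong (take m) ux ⟩
    take m (u ++ [ x ])           ≡⟨ take-length-++ u [ x ] ⟩
    u                             ∎)
    where
    open ≡-Reasoning
    ux : factorAt w a (suc m) ≡ u ++ [ x ]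
    ux = trans same (subst (λ l → factorAt w (length xs) l ≡ u ++ [ x ]) (length-snoc u x) copy)

  record BranchingPair (m : ℕ) : Set where
    field
      a b    : ℕ
      a≢b    : a ≢ b
      last-a : LastOcc w (suc m) a
      last-b : LastOcc w (suc m) b
      same   : factorAt w a m ≡ factorAt w b m

  -- A right special factor u of length m with extensions u x ≠ u y yields a
  -- branching pair: the last occurrences of u x and of u y.
  rightSpecial⇒branching : ∀ m → HasRSOfLength w m → BranchingPair m
  rightSpecial⇒branching m (u , len , x , y , x≢y , ux-factor , uy-factor)
    with extension-lastOcc m u x len ux-factor | extension-lastOcc m u y len uy-factor
  ... | a , last-a , ux , u-at-a | b , last-b , uy , u-at-b = record
    { a = a ; b = b ; last-a = last-a ; last-b = last-b
    ; a≢b = λ { refl → x≢y (∷ʳ-injectiveʳ u u (trans (sym ux) uy)) }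
    ; same = trans u-at-a (sym u-at-b) }

  branching-new : ∀ m (β : BranchingPair m) →
                  ¬ LastOcc w m (BranchingPair.a β) ⊎ ¬ LastOcc w m (BranchingPair.b β)
  branching-new m record { a = a ; b = b ; a≢b = a≢b ; last-a = last-a ; last-b = last-b ; same = same } =
    copies-notBothLast w m a b a≢b (shorter-fits a m (proj₁ last-a)) (shorter-fits b m (proj₁ last-b)) same

  module _ (m : ℕ) where

    complexity-branching-step : BranchingPair m → complexity _≟_ w m ≤ complexity _≟_ w (suc m)
    complexity-branching-step β@record { a = a ; b = b ; last-a = last-a ; last-b = last-b }
      with branching-new m β
    ... | inj₁ ¬last-a = complexity-one-new _≟_ w m a last-a ¬last-a
    ... | inj₂ ¬last-b = complexity-one-new _≟_ w m b last-b ¬last-b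

    module _ (k : ℕ) (K-min : UniqueSuffixesFrom w k) (k≤n : k ≤ length w)
             (m<k : m < k) where

      complexity-suffix-step : complexity _≟_ w m ≤ complexity _≟_ w (suc m)
      complexity-suffix-step with suffix-newLast k K-min k≤n m m<k
      ... | g , last-g , ¬last-g , _ = complexity-one-new _≟_ w m g last-g ¬last-g

      -- If the pair
      -- branches at the suffix, both of its positions are new; otherwise one of
      -- them is new and differs from the position contributed by the suffix.
      complexity-suffix-branching-step : BranchingPair m →
                                         suc (complexity _≟_ w m) ≤ complexity _≟_ w (suc m)
      complexity-suffix-branching-step
        β@record { a = a ; b = b ; a≢b = a≢b ; last-a = last-a ; last-b = last-b ; same = same }
        with suffix-newLast k K-min k≤n m m<k | ≡-dec _≟_ (factorAt w a m) (suffixFactor m)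
      ... | _ | yes a-suffix = complexity-two-new _≟_ w m a b a≢b
              last-a (suffixCopy-notLast m a (proj₁ last-a) a-suffix)
              last-b (suffixCopy-notLast m b (proj₁ last-b) (trans (sym same) a-suffix))
      ... | g , last-g , ¬last-g , g-suffix | no ¬a-suffix with branching-new m β
      ...   | inj₁ ¬last-a = complexity-two-new _≟_ w m a g (λ { refl → ¬a-suffix g-suffix })
                               last-a ¬last-a last-g ¬last-g
      ...   | inj₂ ¬last-b = complexity-two-new _≟_ w m b g (λ { refl → ¬a-suffix (trans same g-suffix) })
                               last-b ¬last-b last-g ¬last-g

  complexity-bound : ∀ k r → IsK w k → IsR w r →
                     complexity _≟_ w 1 + (k ∸ 1) + (r ∸ 1) ≤ length w
  complexity-bound k r isK@(_ , K-min) isR@(_ , _ , below-R) = begin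
    C 1 + (k ∸ 1) + (r ∸ 1)          ≡⟨ cong₂ (λ a b → C 1 + a + b) (sym (m≥n⇒m⊓n≡n k∸1≤n))
                                                                     (sym (m≥n⇒m⊓n≡n (R∸1≤length w r isR))) ⟩
    C 1 + n ⊓ (k ∸ 1) + n ⊓ (r ∸ 1)  ≤⟨ telescope (C ∘ suc) (k ∸ 1) (r ∸ 1) lose stall-k stall-r grow n ⟩
    C (suc n) + n                    ≡⟨ cong (_+ n) (complexity-beyond _≟_ w) ⟩
    n                                ∎
    where
    open ≤-Reasoning
    n : ℕ
    n = length w
    C : ℕ → ℕ
    C = complexity _≟_ w
    k≤n : k ≤ n
    k≤n = K≤length w k isK
    k∸1≤n : k ∸ 1 ≤ n
    k∸1≤n = ≤-trans (m∸n≤m k 1) k≤n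
    branching : ∀ t → t < r ∸ 1 → BranchingPair (suc t)
    branching t t<r∸1 = rightSpecial⇒branching (suc t) (below-R (suc t) (s≤s z≤n) (<∸1⇒suc< t<r∸1))
    lose : ∀ t → C (suc t) ≤ suc (C (suc (suc t)))
    lose t = complexity-lose-one _≟_ w (suc t)
    stall-k : ∀ t → t < k ∸ 1 → C (suc t) ≤ C (suc (suc t))
    stall-k t t<k∸1 = complexity-suffix-step (suc t) k K-min k≤n (<∸1⇒suc< t<k∸1)
    stall-r : ∀ t → t < r ∸ 1 → C (suc t) ≤ C (suc (suc t))
    stall-r t t<r∸1 = complexity-branching-step (suc t) (branching t t<r∸1)
    grow : ∀ t → t < k ∸ 1 → t < r ∸ 1 → suc (C (suc t)) ≤ C (suc (suc t))
    grow t t<k∸1 t<r∸1 =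
      complexity-suffix-branching-step (suc t) k K-min k≤n (<∸1⇒suc< t<k∸1) (branching t t<r∸1)

module _ {A : Set} (_≟_ : DecidableEquality A) where

  open DecMembership _≟_ using (_∈?_)

  lastOcc-cons : (x : A) (xs : List A) (m i : ℕ) → LastOcc xs m i → LastOcc (x ∷ xs) m (suc i)
  lastOcc-cons x xs m i (fits , later) = s≤s fits , later′
    where
    later′ : ∀ j → suc i < j → j + m ≤ suc (length xs) →
             factorAt (x ∷ xs) j m ≢ factorAt (x ∷ xs) (suc i) m
    later′ (suc j) (s≤s i<j) (s≤s fits′) = later j i<j fits′

  shifted-count : (x : A) (xs : List A) (m : ℕ) →
                  complexity _≟_ xs m ≤ count (lastOcc? _≟_ (x ∷ xs) m ∘ suc) (suc (length xs))
  shifted-count x xs m = count-mono (lastOcc? _≟_ xs m) (lastOcc? _≟_ (x ∷ xs) m ∘ suc) (suc (length xs))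
                                    (λ i _ → lastOcc-cons x xs m i)

  complexity-cons : (x : A) (xs : List A) (m : ℕ) → complexity _≟_ xs m ≤ complexity _≟_ (x ∷ xs) m
  complexity-cons x xs m =
    ≤-trans (shifted-count x xs m) (count-shift (lastOcc? _≟_ (x ∷ xs) m) (suc (length xs)))

  window-member : (x : A) (xs : List A) (j : ℕ) → factorAt xs j 1 ≡ [ x ] → x ∈ xs
  window-member x (y ∷ xs) zero    refl = here refl
  window-member x (y ∷ xs) (suc j) same = there (window-member x xs j same)

  complexity-cons-new : (x : A) (xs : List A) → ¬ x ∈ xs →
                        suc (complexity _≟_ xs 1) ≤ complexity _≟_ (x ∷ xs) 1
  complexity-cons-new x xs x∉xs =
    ≤-trans (s≤s (shifted-count x xs 1))
            (count-shift-zero (lastOcc? _≟_ (x ∷ xs) 1) (s≤s z≤n , first) (suc (length xs)))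
    where
    first : ∀ j → 0 < j → j + 1 ≤ suc (length xs) → factorAt (x ∷ xs) j 1 ≢ [ x ]
    first (suc j) _ _ same = x∉xs (window-member x xs j same)

  distinctLetters≤complexity : ∀ w → length (deduplicate _≟_ w) ≤ complexity _≟_ w 1
  distinctLetters≤complexity []       = z≤n
  distinctLetters≤complexity (x ∷ xs) with x ∈? xs
  ... | yes x∈xs = begin
    suc (length (filter (¬? ∘ (x ≟_)) (deduplicate _≟_ xs)))
      ≤⟨ filter-notAll (¬? ∘ (x ≟_)) (deduplicate _≟_ xs)
                       (Any.map (λ x≡y x≢y → x≢y x≡y) (∈-deduplicate⁺ _≟_ x∈xs)) ⟩
    length (deduplicate _≟_ xs)   ≤⟨ distinctLetters≤complexity xs ⟩
    complexity _≟_ xs 1           ≤⟨ complexity-cons x xs 1 ⟩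
    complexity _≟_ (x ∷ xs) 1     ∎
    where open ≤-Reasoning
  ... | no x∉xs = begin
    suc (length (filter (¬? ∘ (x ≟_)) (deduplicate _≟_ xs)))
      ≤⟨ s≤s (length-filter (¬? ∘ (x ≟_)) (deduplicate _≟_ xs)) ⟩
    suc (length (deduplicate _≟_ xs))  ≤⟨ s≤s (distinctLetters≤complexity xs) ⟩
    suc (complexity _≟_ xs 1)          ≤⟨ complexity-cons-new x xs x∉xs ⟩
    complexity _≟_ (x ∷ xs) 1          ∎
    where open ≤-Reasoning

final-arithmetic : ∀ d r k n p → 1 ≤ d → 1 ≤ r → 1 ≤ k →
  d + (k ∸ 1) + (r ∸ 1) ≤ n → n < p + k →
  (r + d ∸ 1 ≤ p) × (p ≡ r + d ∸ 1 → n ≡ r + k + d ∸ 2)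
final-arithmetic (suc d) (suc r) (suc k) n p _ _ _ lower upper = bound , equality
  where
  regroup : ∀ d r k → suc d + k + r ≡ r + suc d + k
  regroup = solve-∀
  regroup₂ : ∀ d r k → suc r + suc k + suc d ≡ 2 + (r + suc d + k)
  regroup₂ = solve-∀
  lower′ : r + suc d + k ≤ n
  lower′ = subst (_≤ n) (regroup d r k) lower
  bound : r + suc d ≤ p
  bound = +-cancelʳ-≤ (suc k) (r + suc d) p
            (≤-trans (≤-reflexive (+-suc (r + suc d) k)) (≤-trans (s≤s lower′) upper))
  equality : p ≡ r + suc d → n ≡ suc r + suc k + suc d ∸ 2
  equality refl = trans (≤-antisym (≤-pred (subst (suc n ≤_) (+-suc (r + suc d) k) upper)) lower′)
                        (cong (_∸ 2) (sym (regroup₂ d r k)))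

proposition2p15 : {A : Set} (_≟_ : DecidableEquality A) (w : List A) → w ≢ [] →
    (p r k : ℕ) → IsMinPeriod w p → IsR w r → IsK w k →
    (r + length (deduplicate _≟_ w) ∸ 1 ≤ p)
    × (p ≡ r + length (deduplicate _≟_ w) ∸ 1 →
       length w ≡ r + k + length (deduplicate _≟_ w) ∸ 2)
proposition2p15 _≟_ [] w≢[] p r k _ _ _ = contradiction refl w≢[]
proposition2p15 _≟_ w@(_ ∷ _) _ p r k (period , _) isR@(1≤r , _) isK =
  final-arithmetic (length (deduplicate _≟_ w)) r k (length w) p (s≤s z≤n) 1≤r
    (K-positive w k isK (s≤s z≤n)) letters+K+R≤n (period-bound w p k period isK)
  where
  letters+K+R≤n : length (deduplicate _≟_ w) + (k ∸ 1) + (r ∸ 1) ≤ length w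
  letters+K+R≤n =
    ≤-trans (+-monoˡ-≤ (r ∸ 1) (+-monoˡ-≤ (k ∸ 1) (distinctLetters≤complexity _≟_ w)))
            (complexity-bound _≟_ w k r isK isR)
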